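{- Let $G$ be a connected triangle-free graph with no full star-cutset that is not a path on at most $4$ vertices. Then every subdivision $G^*$ of $G$ is a connected triangle-free graph with no full star-cutset.
   Context: A full star-cutset in a connected graph $G$ is a set $N[u]=\{u\}\cup N(u)$ whose removal disconnects $G$. A subdivision of $G$ is obtained by replacing edges of $G$ by paths with new internal vertices. -}

module Defs where

open import Data.Nat using (ℕ; zero; suc; _≤_)
open import Data.Nat.Properties using (n<1+n; <-irrefl)
open import Data.Fin using (Fin; zero; suc; toℕ; _≟_)
open import Data.Bool using (Bool; true; false; _∧_; _∨_; not)
open import Data.Bool.Properties using (∧-comm; ∨-comm)
open import Data.Product using (Σ; ∃; _×_; _,_)
open import Data.Sum using (_⊎_)
open import Data.Unit using (⊤)
open import Data.Empty using (⊥; ⊥-elim)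
open import Relation.Nullary using (¬_; yes; no)
open import Relation.Nullary.Decidable using (⌊_⌋)
open import Relation.Binary.PropositionalEquality using (_≡_; refl; cong₂)
open import Function.Bundles using (_↔_; Inverse)

import Data.Nat as ℕ

record Graph : Set where
  field
    n       : ℕ
    adj     : Fin n → Fin n → Bool
    adj-sym : ∀ i j → adj i j ≡ adj j i
    adj-irr : ∀ i → adj i i ≡ false
open Graph public

V : Graph → Set
V G = Fin (n G)

Adjacent : (G : Graph) → V G → V G → Set
Adjacent G i j = adj G i j ≡ true

InClosedNbhd : (G : Graph) → V G → V G → Set
InClosedNbhd G u x = (x ≡ u) ⊎ Adjacent G u x

-- Walks in G all of whose vertices satisfy P (i.e. walks in the induced subgraph G[P]).
data WalkIn (G : Graph) (P : V G → Set) : V G → V G → Set where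
  nil  : ∀ {x} → P x → WalkIn G P x x
  cons : ∀ {x y z} → P x → Adjacent G x y → WalkIn G P y z → WalkIn G P x z

AllV : (G : Graph) → V G → Set
AllV G _ = ⊤

Connected : Graph → Set
Connected G = ∀ x y → WalkIn G (AllV G) x y

TriangleFree : Graph → Set
TriangleFree G = ¬ (Σ (V G) λ x → Σ (V G) λ y → Σ (V G) λ z →
                    Adjacent G x y × Adjacent G y z × Adjacent G x z)

IsFullStarCutset : (G : Graph) → V G → Set
IsFullStarCutset G u =
  Σ (V G) λ x → Σ (V G) λ y →
    ¬ InClosedNbhd G u x × ¬ InClosedNbhd G u y ×
    ¬ WalkIn G (λ z → ¬ InClosedNbhd G u z) x y

HasFullStarCutset : Graph → Set
HasFullStarCutset G = Σ (V G) λ u → IsFullStarCutset G u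

record _≅_ (G H : Graph) : Set where
  field
    bij      : V G ↔ V H
    preserve : ∀ i j → adj G i j ≡ adj H (Inverse.to bij i) (Inverse.to bij j)

pathGraph : ℕ → Graph
pathGraph k = record { n = k ; adj = a ; adj-sym = s ; adj-irr = r }
  where
  a : Fin k → Fin k → Bool
  a i j = ⌊ toℕ i ℕ.≟ suc (toℕ j) ⌋ ∨ ⌊ toℕ j ℕ.≟ suc (toℕ i) ⌋
  s : ∀ i j → a i j ≡ a j i
  s i j = ∨-comm ⌊ toℕ i ℕ.≟ suc (toℕ j) ⌋ ⌊ toℕ j ℕ.≟ suc (toℕ i) ⌋
  r : ∀ i → a i i ≡ false
  r i with toℕ i ℕ.≟ suc (toℕ i)
  ... | yes p = ⊥-elim (<-irrefl p (n<1+n (toℕ i)))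
  ... | no _ = refl

IsSmallPath : Graph → Set
IsSmallPath G = Σ ℕ λ k → 1 ≤ k × k ≤ 4 × (G ≅ pathGraph k)

-- Elementary subdivision of the edge uv: a new vertex (index zero) is
-- inserted; the edge uv is removed and edges u–new, new–v are added.
subdivideEdge : (G : Graph) → V G → V G → Graph
subdivideEdge G u v = record { n = suc (n G) ; adj = a ; adj-sym = s ; adj-irr = r }
  where
  end : V G → Bool
  end i = ⌊ i ≟ u ⌋ ∨ ⌊ i ≟ v ⌋
  a : Fin (suc (n G)) → Fin (suc (n G)) → Bool
  a zero zero = false
  a zero (suc j) = end j
  a (suc i) zero = end i
  a (suc i) (suc j) = adj G i j ∧ not (end i ∧ end j)
  s : ∀ i j → a i j ≡ a j i
  s zero zero = refl
  s zero (suc j) = refl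
  s (suc i) zero = refl
  s (suc i) (suc j) = cong₂ _∧_ (adj-sym G i j) (Relation.Binary.PropositionalEquality.cong not (∧-comm (end i) (end j)))
  r : ∀ i → a i i ≡ false
  r zero = refl
  r (suc i) rewrite adj-irr G i = refl

-- H is a subdivision of G: H is (isomorphic to) a graph obtained from G by a
-- finite sequence of elementary edge subdivisions, i.e. by replacing edges of
-- G by paths with new internal vertices.
data Subdivision (G : Graph) : Graph → Set where
  base : ∀ {H} → G ≅ H → Subdivision G H
  step : ∀ {H K} → Subdivision G H → (u v : V H) → Adjacent H u v →
         K ≅ subdivideEdge H u v → Subdivision G K

module Submission where

open import Defs
open import Data.Product using (_×_)
open import Relation.Nullary using (¬_)

-- Absence of full star-cutsets is used in the form "N[c] does not separate"
-- (StarConnected, read up to double negation since walks are not decided).  The theorem follows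
-- by induction on the subdivision, with invariant "good and not a short
-- path": a good graph with an edge that is not a short path has at least
-- four vertices, so each subdivision has at least five.

open import Data.Nat using (_≤_; z≤n; s≤s)
open import Data.Nat.Properties using (≤-refl; ≤-trans; ≤⇒≯)
open import Data.Fin using (Fin; zero; suc; _≟_)
open import Data.Fin.Properties using (any?; all?; ¬∀⟶∃¬; injective⇒≤; suc-injective)
open import Data.Bool using (Bool; true; false; _∨_)
import Data.Bool.Properties as Bool
open import Data.Product using (∃; ∃₂; _,_; proj₁; proj₂)
open import Data.Sum using (_⊎_; inj₁; inj₂; [_,_]; swap)
open import Data.Unit using (tt)
open import Data.Empty using (⊥; ⊥-elim)
open import Data.Vec using (Vec; []; _∷_; lookup)
open import Data.Vec.Membership.Propositional using (_∈_; _∉_)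
import Data.Vec.Membership.DecPropositional as DecMembership
open import Data.Vec.Relation.Unary.Any using (here; there; index)
open import Data.Vec.Relation.Unary.Any.Properties using (lookup-index)
open import Data.Vec.Relation.Unary.All using ([]; _∷_)
open import Data.Vec.Relation.Unary.AllPairs using ([]; _∷_)
open import Data.Vec.Relation.Unary.Unique.Propositional using (Unique)
open import Data.Vec.Relation.Unary.Unique.Propositional.Properties using (lookup-injective)
open import Effect.Monad using (RawMonad)
open import Function.Base using (_∘_; id)
open import Function.Bundles using (Inverse; mk↔ₛ′)
open import Function.Properties.Inverse using (↔-sym; ↔-trans)
open import Level using (0ℓ)
open import Relation.Nullary using (Dec; yes; no)
open import Relation.Nullary.Decidable
  using (⌊_⌋; _⊎-dec_; _×-dec_; ¬?; decidable-stable; dec-true; dec-false; isYes≗does)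
open import Relation.Nullary.Negation using (¬¬-Monad; ¬¬-map)
open import Relation.Unary using (Decidable)
open import Relation.Binary.PropositionalEquality
  using (_≡_; _≢_; refl; sym; trans; cong; cong₂; subst; subst₂)

open RawMonad (¬¬-Monad {0ℓ})

Outside : (G : Graph) → V G → V G → Set
Outside G c z = ¬ InClosedNbhd G c z

StarConnected : (G : Graph) → V G → Set
StarConnected G c = ∀ {a b} → Outside G c a → Outside G c b →
  ¬ ¬ WalkIn G (Outside G c) a b

module GraphFacts (G : Graph) where

  adj-symm : ∀ {x y} → Adjacent G x y → Adjacent G y x
  adj-symm {x} {y} xy = trans (adj-sym G y x) xy

  adj⇒≢ : ∀ {x y} → Adjacent G x y → x ≢ y
  adj⇒≢ {x} xy refl with trans (sym xy) (adj-irr G x)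
  ... | ()

  ¬adj⇒false : ∀ {x y} → ¬ Adjacent G x y → adj G x y ≡ false
  ¬adj⇒false = Bool.¬-not

  adj? : ∀ x y → Dec (Adjacent G x y)
  adj? x y = adj G x y Bool.≟ true

  inClosedNbhd? : ∀ c z → Dec (InClosedNbhd G c z)
  inClosedNbhd? c z = (z ≟ c) ⊎-dec adj? c z

  outside : ∀ {c z} → z ≢ c → ¬ Adjacent G c z → Outside G c z
  outside z≢c ¬cz = [ z≢c , ¬cz ]

  neighbour-outside : TriangleFree G → ∀ {x y z} → Adjacent G x y → Adjacent G x z →
    z ≢ y → Outside G y z
  neighbour-outside tf xy xz z≢y = outside z≢y λ yz → tf (_ , _ , _ , xy , yz , xz)

  walk-first : ∀ {P x y} → WalkIn G P x y → P x
  walk-first (nil p) = p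
  walk-first (cons p _ _) = p

  _++ʷ_ : ∀ {P x y z} → WalkIn G P x y → WalkIn G P y z → WalkIn G P x z
  nil _ ++ʷ w′ = w′
  cons p xy w ++ʷ w′ = cons p xy (w ++ʷ w′)

  snocʷ : ∀ {P x y z} → WalkIn G P x y → Adjacent G y z → P z → WalkIn G P x z
  snocʷ (nil p) yz q = cons p yz (nil q)
  snocʷ (cons p xy w) yz q = cons p xy (snocʷ w yz q)

  reverseʷ : ∀ {P x y} → WalkIn G P x y → WalkIn G P y x
  reverseʷ (nil p) = nil p
  reverseʷ (cons p xy w) = snocʷ (reverseʷ w) (adj-symm xy) p

  weakenʷ : ∀ {P Q : V G → Set} {x y} → (∀ {z} → P z → Q z) → WalkIn G P x y → WalkIn G Q x y
  weakenʷ f (nil p) = nil (f p)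
  weakenʷ f (cons p xy w) = cons (f p) xy (weakenʷ f w)

  walk-leaves : ∀ {P S : V G → Set} → Decidable S → ∀ {x y} → S x → ¬ S y →
    WalkIn G P x y → ∃₂ λ s t → S s × ¬ S t × P t × Adjacent G s t
  walk-leaves S? sx ¬sy (nil _) = ⊥-elim (¬sy sx)
  walk-leaves S? {x} sx ¬sy (cons _ xz w) with S? _
  ... | yes sz = walk-leaves S? sz ¬sy w
  ... | no ¬sz = x , _ , sx , ¬sz , walk-first w , xz

  walk-in-neighbourhood : TriangleFree G → ∀ {P : V G → Set} c →
    (∀ {z} → P z → Adjacent G c z) → ∀ {x y} → WalkIn G P x y → x ≡ y
  walk-in-neighbourhood tf c inN (nil _) = refl
  walk-in-neighbourhood tf c inN (cons p xz w) =
    ⊥-elim (tf (c , _ , _ , inN p , xz , inN (walk-first w)))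

  pendant-walk : ∀ {p q} → (∀ {z} → Adjacent G q z → z ≡ p) →
    ∀ {P : V G → Set} {y} → ¬ P p → WalkIn G P q y → y ≡ q
  pendant-walk only-p ¬Pp (nil _) = refl
  pendant-walk only-p {P} ¬Pp (cons _ qz w) = ⊥-elim (¬Pp (subst P (only-p qz) (walk-first w)))

  noCutset⇒starConnected : ¬ HasFullStarCutset G → ∀ c → StarConnected G c
  noCutset⇒starConnected nc c na nb nw = nc (c , _ , _ , na , nb , nw)

  starConnected⇒noCutset : (∀ c → StarConnected G c) → ¬ HasFullStarCutset G
  starConnected⇒noCutset sc (c , a , b , na , nb , nw) = sc c na nb nw

  open DecMembership (_≟_ {n G}) using (_∈?_)

  PathShaped : ∀ {k} → Vec (V G) k → Set
  PathShaped {k} xs = ∀ i j → adj G (lookup xs i) (lookup xs j) ≡ adj (pathGraph k) i j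

  spanning-induced-path : ∀ {k} (xs : Vec (V G) k) → Unique xs → (∀ z → z ∈ xs) →
    PathShaped xs → G ≅ pathGraph k
  spanning-induced-path {k} xs unique cover shape = record
    { bij = mk↔ₛ′ position (lookup xs) position-lookup lookup-position
    ; preserve = preserve }
    where
    position : V G → Fin k
    position z = index (cover z)
    lookup-position : ∀ z → lookup xs (position z) ≡ z
    lookup-position z = sym (lookup-index (cover z))
    position-lookup : ∀ i → position (lookup xs i) ≡ i
    position-lookup i = lookup-injective unique _ _ (lookup-position (lookup xs i))
    preserve : ∀ x y → adj G x y ≡ adj (pathGraph k) (position x) (position y)
    preserve x y = trans (sym (cong₂ (adj G) (lookup-position x) (lookup-position y))) (shape _ _)

  path₂ : ∀ {a b} → Adjacent G a b → (∀ z → z ∈ a ∷ b ∷ []) → G ≅ pathGraph 2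
  path₂ {a} {b} ab cover = spanning-induced-path (a ∷ b ∷ []) unique cover shape
    where
    unique : Unique (a ∷ b ∷ [])
    unique = (adj⇒≢ ab ∷ []) ∷ [] ∷ []
    shape : PathShaped (a ∷ b ∷ [])
    shape zero zero = adj-irr G a
    shape zero (suc zero) = ab
    shape (suc zero) zero = adj-symm ab
    shape (suc zero) (suc zero) = adj-irr G b

  path₃ : ∀ {a b c} → Adjacent G a b → Adjacent G b c → ¬ Adjacent G a c → a ≢ c →
    (∀ z → z ∈ a ∷ b ∷ c ∷ []) → G ≅ pathGraph 3
  path₃ {a} {b} {c} ab bc ¬ac a≢c cover = spanning-induced-path (a ∷ b ∷ c ∷ []) unique cover shape
    where
    unique : Unique (a ∷ b ∷ c ∷ [])
    unique = (adj⇒≢ ab ∷ a≢c ∷ []) ∷ (adj⇒≢ bc ∷ []) ∷ [] ∷ []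
    shape : PathShaped (a ∷ b ∷ c ∷ [])
    shape zero zero = adj-irr G a
    shape zero (suc zero) = ab
    shape zero (suc (suc zero)) = ¬adj⇒false ¬ac
    shape (suc zero) zero = adj-symm ab
    shape (suc zero) (suc zero) = adj-irr G b
    shape (suc zero) (suc (suc zero)) = bc
    shape (suc (suc zero)) zero = ¬adj⇒false (¬ac ∘ adj-symm)
    shape (suc (suc zero)) (suc zero) = adj-symm bc
    shape (suc (suc zero)) (suc (suc zero)) = adj-irr G c

  -- For four vertices distinctness follows from the adjacency shape.
  path₄ : ∀ {a b c d} → Adjacent G a b → Adjacent G b c → Adjacent G c d →
    ¬ Adjacent G a c → ¬ Adjacent G b d → ¬ Adjacent G a d →
    (∀ z → z ∈ a ∷ b ∷ c ∷ d ∷ []) → G ≅ pathGraph 4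
  path₄ {a} {b} {c} {d} ab bc cd ¬ac ¬bd ¬ad cover =
    spanning-induced-path (a ∷ b ∷ c ∷ d ∷ []) unique cover shape
    where
    unique : Unique (a ∷ b ∷ c ∷ d ∷ [])
    unique = (adj⇒≢ ab ∷ (λ { refl → ¬ad cd }) ∷ (λ { refl → ¬bd (adj-symm ab) }) ∷ [])
           ∷ (adj⇒≢ bc ∷ (λ { refl → ¬ad ab }) ∷ [])
           ∷ (adj⇒≢ cd ∷ []) ∷ [] ∷ []
    shape : PathShaped (a ∷ b ∷ c ∷ d ∷ [])
    shape zero zero = adj-irr G a
    shape zero (suc zero) = ab
    shape zero (suc (suc zero)) = ¬adj⇒false ¬ac
    shape zero (suc (suc (suc zero))) = ¬adj⇒false ¬ad
    shape (suc zero) zero = adj-symm ab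
    shape (suc zero) (suc zero) = adj-irr G b
    shape (suc zero) (suc (suc zero)) = bc
    shape (suc zero) (suc (suc (suc zero))) = ¬adj⇒false ¬bd
    shape (suc (suc zero)) zero = ¬adj⇒false (¬ac ∘ adj-symm)
    shape (suc (suc zero)) (suc zero) = adj-symm bc
    shape (suc (suc zero)) (suc (suc zero)) = adj-irr G c
    shape (suc (suc zero)) (suc (suc (suc zero))) = cd
    shape (suc (suc (suc zero))) zero = ¬adj⇒false (¬ad ∘ adj-symm)
    shape (suc (suc (suc zero))) (suc zero) = ¬adj⇒false (¬bd ∘ adj-symm)
    shape (suc (suc (suc zero))) (suc (suc zero)) = adj-symm cd
    shape (suc (suc (suc zero))) (suc (suc (suc zero))) = adj-irr G d

  covered? : ∀ {k} (xs : Vec (V G) k) → (∀ z → z ∈ xs) ⊎ ∃ λ z → z ∉ xs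
  covered? xs with all? (λ z → z ∈? xs)
  ... | yes cover = inj₁ cover
  ... | no ¬cover = inj₂ (¬∀⟶∃¬ _ _ (λ z → z ∈? xs) ¬cover)

  induced-P₃⇒four : ¬ IsSmallPath G → ∀ {a b c} → Adjacent G a b → Adjacent G b c →
    ¬ Adjacent G a c → a ≢ c → 4 ≤ n G
  induced-P₃⇒four nsp {a} {b} {c} ab bc ¬ac a≢c with covered? (a ∷ b ∷ c ∷ [])
  ... | inj₁ cover =
    ⊥-elim (nsp (3 , s≤s z≤n , s≤s (s≤s (s≤s z≤n)) , path₃ ab bc ¬ac a≢c cover))
  ... | inj₂ (z , z∉) = injective⇒≤ (lookup-injective unique _ _)
    where
    unique : Unique (a ∷ b ∷ c ∷ z ∷ [])
    unique = (adj⇒≢ ab ∷ a≢c ∷ (λ e → z∉ (here (sym e))) ∷ [])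
           ∷ (adj⇒≢ bc ∷ (λ e → z∉ (there (here (sym e)))) ∷ [])
           ∷ ((λ e → z∉ (there (there (here (sym e))))) ∷ []) ∷ [] ∷ []

  -- A connected triangle-free graph with an edge that is not a path on at
  -- most four vertices has at least four vertices: the edge extends to an
  -- induced path on three vertices unless it is all of G.
  four-vertices : Connected G → TriangleFree G → ¬ IsSmallPath G →
    ∀ {u v} → Adjacent G u v → 4 ≤ n G
  four-vertices con tf nsp {u} {v} uv with covered? (u ∷ v ∷ [])
  ... | inj₁ cover = ⊥-elim (nsp (2 , s≤s z≤n , s≤s (s≤s z≤n) , path₂ uv cover))
  ... | inj₂ (w , w∉) with walk-leaves (λ z → z ∈? u ∷ v ∷ []) (here refl) w∉ (con u w)
  ... | _ , t , here refl , t∉ , _ , ut =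
    induced-P₃⇒four nsp (adj-symm ut) uv (λ tv → tf (t , u , v , adj-symm ut , uv , tv))
      (λ e → t∉ (there (here e)))
  ... | _ , t , there (here refl) , t∉ , _ , vt =
    induced-P₃⇒four nsp uv vt (λ ut → tf (u , v , t , uv , vt , ut)) (λ e → t∉ (here (sym e)))

mapʷ : ∀ {G H : Graph} {P : V G → Set} {Q : V H → Set} (f : V G → V H) →
  (∀ {x y} → Adjacent G x y → Adjacent H (f x) (f y)) → (∀ {z} → P z → Q (f z)) →
  ∀ {x y} → WalkIn G P x y → WalkIn H Q (f x) (f y)
mapʷ f fa fp (nil p) = nil (fp p)
mapʷ f fa fp (cons p xy w) = cons (fp p) (fa xy) (mapʷ f fa fp w)

Good : Graph → Set
Good G = Connected G × TriangleFree G × ¬ HasFullStarCutset G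

module Iso {G H : Graph} (φ : G ≅ H) where
  open _≅_ φ

  to : V G → V H
  to = Inverse.to bij

  from : V H → V G
  from = Inverse.from bij

  to-from : ∀ y → to (from y) ≡ y
  to-from y = Inverse.inverseˡ bij refl

  from-to : ∀ x → from (to x) ≡ x
  from-to x = Inverse.inverseʳ bij refl

  to-injective : ∀ {x y} → to x ≡ to y → x ≡ y
  to-injective {x} {y} e = trans (sym (from-to x)) (trans (cong from e) (from-to y))

  adj-from-≡ : ∀ x y → adj H x y ≡ adj G (from x) (from y)
  adj-from-≡ x y =
    sym (trans (preserve (from x) (from y)) (cong₂ (adj H) (to-from x) (to-from y)))

  adj-to : ∀ {x y} → Adjacent G x y → Adjacent H (to x) (to y)
  adj-to {x} {y} xy = trans (sym (preserve x y)) xy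

  outside-to : ∀ {c z} → Outside G c z → Outside H (to c) (to z)
  outside-to {c} {z} o =
    GraphFacts.outside H (o ∘ inj₁ ∘ to-injective) (λ a → o (inj₂ (trans (preserve c z) a)))

≅-sym : ∀ {G H} → G ≅ H → H ≅ G
≅-sym φ = record { bij = ↔-sym (_≅_.bij φ) ; preserve = Iso.adj-from-≡ φ }

≅-trans : ∀ {G H K} → G ≅ H → H ≅ K → G ≅ K
≅-trans φ ψ = record
  { bij = ↔-trans (_≅_.bij φ) (_≅_.bij ψ)
  ; preserve = λ i j → trans (_≅_.preserve φ i j) (_≅_.preserve ψ _ _) }

≅⇒≤ : ∀ {G H} → G ≅ H → n G ≤ n H
≅⇒≤ φ = injective⇒≤ (Iso.to-injective φ)

good-transport : ∀ {G H} → G ≅ H → Good G → Good H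
good-transport {G} {H} φ (con , tf , nc) = con′ , tf′ , nc′
  where
  open Iso φ
  open Iso (≅-sym φ) using () renaming (adj-to to adj-from; outside-to to outside-from)

  con′ : Connected H
  con′ x y = subst₂ (WalkIn H (AllV H)) (to-from x) (to-from y)
    (mapʷ to adj-to (λ _ → tt) (con (from x) (from y)))

  tf′ : TriangleFree H
  tf′ (x , y , z , xy , yz , xz) =
    tf (from x , from y , from z , adj-from xy , adj-from yz , adj-from xz)

  nc′ : ¬ HasFullStarCutset H
  nc′ (c , a , b , na , nb , nw) =
    nc (from c , from a , from b , outside-from na , outside-from nb , λ w →
      nw (subst₂ (WalkIn H (Outside H c)) (to-from a) (to-from b)
           (mapʷ to adj-to (subst (λ t → Outside H t _) (to-from c) ∘ outside-to) w)))

smallPath-transport : ∀ {G H} → G ≅ H → IsSmallPath H → IsSmallPath G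
smallPath-transport φ (k , 1≤k , k≤4 , ψ) = k , 1≤k , k≤4 , ≅-trans φ ψ

smallPath-size : ∀ {G} → IsSmallPath G → n G ≤ 4
smallPath-size (k , _ , k≤4 , φ) = ≤-trans (≅⇒≤ φ) k≤4

OneOf : ∀ {A : Set} → A → A → A → Set
OneOf x y z = z ≡ x ⊎ z ≡ y

avoid-swap : ∀ {A : Set} {x y z : A} → ¬ OneOf y x z → ¬ OneOf x y z
avoid-swap ¬o = ¬o ∘ swap

module GoodNotP₄ (G : Graph) (good : Good G) (notP₄ : ¬ G ≅ pathGraph 4) where
  open GraphFacts G

  connected : Connected G
  connected = proj₁ good

  triangleFree : TriangleFree G
  triangleFree = proj₁ (proj₂ good)

  starConnected : ∀ c → StarConnected G c
  starConnected = noCutset⇒starConnected (proj₂ (proj₂ good))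

  outside-edge-end : ∀ {x y z} → Adjacent G x y → Outside G x z → ¬ OneOf x y z
  outside-edge-end xy o (inj₁ refl) = o (inj₁ refl)
  outside-edge-end xy o (inj₂ refl) = o (inj₂ xy)

  StarsCover : V G → V G → Set
  StarsCover x y = ∀ c → InClosedNbhd G x c ⊎ InClosedNbhd G y c

  stars-cover? : ∀ x y → (∃ λ c → Outside G x c × Outside G y c) ⊎ StarsCover x y
  stars-cover? x y with all? (λ c → inClosedNbhd? x c ⊎-dec inClosedNbhd? y c)
  ... | yes cover = inj₂ cover
  ... | no ¬cover =
    let (c , ¬c) = ¬∀⟶∃¬ _ _ (λ c → inClosedNbhd? x c ⊎-dec inClosedNbhd? y c) ¬cover
    in inj₁ (c , ¬c ∘ inj₁ , ¬c ∘ inj₂)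

  -- If N[x] ∪ N[y] covers G, then x has at most one neighbour outside
  -- N[y]: two such neighbours are joined outside N[y], hence by a walk
  -- inside N(x), which is trivial in a triangle-free graph.
  private-neighbour-unique : ∀ {x y} → StarsCover x y → Adjacent G x y →
    ∀ {a z} → Adjacent G x a → a ≢ y → Adjacent G x z → z ≢ y → a ≡ z
  private-neighbour-unique {x} {y} cover xy xa a≢y xz z≢y =
    decidable-stable (_ ≟ _)
      (¬¬-map (walk-in-neighbourhood triangleFree x inN)
        (starConnected y (neighbour-outside triangleFree xy xa a≢y)
                         (neighbour-outside triangleFree xy xz z≢y)))
    where
    inN : ∀ {w} → Outside G y w → Adjacent G x w
    inN {w} o with cover w
    ... | inj₁ (inj₁ refl) = ⊥-elim (o (inj₂ (adj-symm xy)))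
    ... | inj₁ (inj₂ xw) = xw
    ... | inj₂ n = ⊥-elim (o n)

  route : ∀ {x y a a′ b′ b} → Adjacent G x y → Outside G y a → Outside G y a′ →
    WalkIn G (¬_ ∘ OneOf x y) a′ b′ → Outside G x b′ → Outside G x b →
    ¬ ¬ WalkIn G (¬_ ∘ OneOf x y) a b
  route xy aOy a′Oy middle b′Ox bOx = do
    first ← starConnected _ aOy a′Oy
    last ← starConnected _ b′Ox bOx
    pure (weakenʷ (avoid-swap ∘ outside-edge-end (adj-symm xy)) first
          ++ʷ (middle ++ʷ weakenʷ (outside-edge-end xy) last))

  spanned-by-edge : ∀ {x y a b} → StarsCover x y → Adjacent G x y →
    Adjacent G x a → a ≢ y → Adjacent G y b → b ≢ x → ∀ z → z ∈ a ∷ x ∷ y ∷ b ∷ []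
  spanned-by-edge {x} {y} cover xy xa a≢y yb b≢x z with cover z | z ≟ x | z ≟ y
  ... | _ | yes z≡x | _ = there (here z≡x)
  ... | _ | _ | yes z≡y = there (there (here z≡y))
  ... | inj₁ (inj₁ z≡x) | no z≢x | _ = ⊥-elim (z≢x z≡x)
  ... | inj₂ (inj₁ z≡y) | _ | no z≢y = ⊥-elim (z≢y z≡y)
  ... | inj₁ (inj₂ xz) | _ | no z≢y = here (sym (private-neighbour-unique cover xy xa a≢y xz z≢y))
  ... | inj₂ (inj₂ yz) | no z≢x | _ = there (there (there (here (sym
    (private-neighbour-unique (swap ∘ cover) (adj-symm xy) yb b≢x yz z≢x)))))

  -- A neighbour a of x and a neighbour b of y, off the edge xy, are joined
  -- in G − {x, y}: through a vertex outside N[x] ∪ N[y] if there is one,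
  -- directly if a ~ b, and otherwise G would be the path a–x–y–b.
  across-edge : ∀ {x y a b} → Adjacent G x y → Adjacent G x a → a ≢ y →
    Adjacent G y b → b ≢ x → ¬ ¬ WalkIn G (¬_ ∘ OneOf x y) a b
  across-edge {x} {y} {a} {b} xy xa a≢y yb b≢x =
    [ through-third , (λ cover → direct-or-P₄ cover (adj? a b)) ] (stars-cover? x y)
    where
    aOy : Outside G y a
    aOy = neighbour-outside triangleFree xy xa a≢y
    bOx : Outside G x b
    bOx = neighbour-outside triangleFree (adj-symm xy) yb b≢x

    through-third : (∃ λ c → Outside G x c × Outside G y c) → ¬ ¬ WalkIn G (¬_ ∘ OneOf x y) a b
    through-third (c , cOx , cOy) = route xy aOy cOy (nil (outside-edge-end xy cOx)) cOx bOx

    direct-or-P₄ : StarsCover x y → Dec (Adjacent G a b) → ¬ ¬ WalkIn G (¬_ ∘ OneOf x y) a b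
    direct-or-P₄ _ (yes ab) = route xy aOy aOy
      (cons (avoid-swap (outside-edge-end (adj-symm xy) aOy)) ab (nil (outside-edge-end xy bOx)))
      bOx bOx
    direct-or-P₄ cover (no ¬ab) = ⊥-elim (notP₄ (path₄ (adj-symm xa) xy yb
      (λ ay → aOy (inj₂ (adj-symm ay))) (λ xb → bOx (inj₂ xb)) ¬ab
      (spanned-by-edge cover xy xa a≢y yb b≢x)))

  -- Unless a and b lie on different sides of the edge, they are both
  -- outside N[x] or both outside N[y], and that star does not separate.
  edge-deletion : ∀ {x y a b} → Adjacent G x y → ¬ OneOf x y a → ¬ OneOf x y b →
    ¬ ¬ WalkIn G (¬_ ∘ OneOf x y) a b
  edge-deletion {x} {y} {a} {b} xy a∉ b∉ with adj? x a | adj? x b | adj? y a | adj? y b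
  ... | yes xa | _ | yes ya | _ = ⊥-elim (triangleFree (x , y , a , xy , ya , xa))
  ... | _ | yes xb | _ | yes yb = ⊥-elim (triangleFree (x , y , b , xy , yb , xb))
  ... | no ¬xa | no ¬xb | _ | _ = ¬¬-map (weakenʷ (outside-edge-end xy))
    (starConnected x (outside (a∉ ∘ inj₁) ¬xa) (outside (b∉ ∘ inj₁) ¬xb))
  ... | _ | _ | no ¬ya | no ¬yb = ¬¬-map (weakenʷ (avoid-swap ∘ outside-edge-end (adj-symm xy)))
    (starConnected y (outside (a∉ ∘ inj₂) ¬ya) (outside (b∉ ∘ inj₂) ¬yb))
  ... | yes xa | _ | no _ | yes yb = across-edge xy xa (a∉ ∘ inj₂) yb (b∉ ∘ inj₁)
  ... | no _ | yes xb | yes ya | _ =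
    ¬¬-map (weakenʷ avoid-swap) (across-edge (adj-symm xy) ya (a∉ ∘ inj₁) xb (b∉ ∘ inj₂))

  -- If q is pendant at p (its only neighbour), N[p] is all of G.  Otherwise
  -- a walk from p to a vertex b outside N[p] leaves {p, q} along an edge pa,
  -- and the stars of a and b force G to be the path q–p–a–b.
  module Pendant {p q} (pq : Adjacent G p q) (only-p : ∀ {z} → Adjacent G q z → z ≡ p) where

    outside-p⇒≢q : ∀ {y} → Outside G p y → y ≢ q
    outside-p⇒≢q yOp refl = yOp (inj₂ pq)

    p-has-other-neighbour : ∀ {b} → Outside G p b → ∃ λ a → Adjacent G p a × a ≢ q
    p-has-other-neighbour {b} bOp
      with walk-leaves (λ z → (z ≟ p) ⊎-dec (z ≟ q)) (inj₁ refl) b∉ (connected p b)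
      where
      b∉ : ¬ OneOf p q b
      b∉ = [ bOp ∘ inj₁ , outside-p⇒≢q bOp ]
    ... | _ , t , inj₁ refl , t∉ , _ , pt = t , pt , t∉ ∘ inj₂
    ... | _ , t , inj₂ refl , t∉ , _ , qt = ⊥-elim (t∉ (inj₁ (only-p qt)))

    module _ {a} (pa : Adjacent G p a) (a≢q : a ≢ q) where

      q-outside-a : Outside G a q
      q-outside-a = outside (a≢q ∘ sym) λ aq → adj⇒≢ pa (sym (only-p (adj-symm aq)))

      -- a is adjacent to every vertex outside N[p]: otherwise N[a] would
      -- separate such a vertex from q.
      a-sees-outside : ∀ {y} → Outside G p y → Adjacent G a y
      a-sees-outside {y} yOp with adj? a y
      ... | yes ay = ay
      ... | no ¬ay = ⊥-elim (starConnected a q-outside-a yOa λ w →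
                       outside-p⇒≢q yOp (pendant-walk only-p (λ o → o (inj₂ (adj-symm pa))) w))
        where
        yOa : Outside G a y
        yOa = outside (λ { refl → yOp (inj₂ pa) }) ¬ay

      -- a is the only neighbour of p besides q: another one would be
      -- separated from q by N[a].
      only-a : ∀ {x} → Adjacent G p x → x ≢ q → x ≡ a
      only-a {x} px x≢q with x ≟ a
      ... | yes x≡a = x≡a
      ... | no x≢a = ⊥-elim (starConnected a q-outside-a (neighbour-outside triangleFree pa px x≢a)
                       λ w → x≢q (pendant-walk only-p (λ o → o (inj₂ (adj-symm pa))) w))

      -- At most one vertex lies outside N[p]: from q, a walk outside N[b]
      -- can only reach p, whose other neighbour a is in N[b].
      only-b : ∀ {b y} → Outside G p b → Outside G p y → y ≡ b
      only-b {b} {y} bOp yOp with y ≟ b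
      ... | yes y≡b = y≡b
      ... | no y≢b = ⊥-elim (starConnected b qOb yOb λ w → stuck (walk-leaves
              (λ z → (z ≟ q) ⊎-dec (z ≟ p)) (inj₁ refl) [ outside-p⇒≢q yOp , yOp ∘ inj₁ ] w))
        where
        qOb : Outside G b q
        qOb = outside (outside-p⇒≢q bOp ∘ sym) λ bq → bOp (inj₁ (only-p (adj-symm bq)))
        yOb : Outside G b y
        yOb = neighbour-outside triangleFree (a-sees-outside bOp) (a-sees-outside yOp) y≢b
        stuck : ¬ (∃₂ λ s t → OneOf q p s × ¬ OneOf q p t × Outside G b t × Adjacent G s t)
        stuck (_ , t , inj₁ refl , t∉ , _ , qt) = t∉ (inj₂ (only-p qt))
        stuck (_ , t , inj₂ refl , t∉ , tOb , pt) =
          tOb (inj₂ (subst (Adjacent G b) (sym (only-a pt (t∉ ∘ inj₁)))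
                                          (adj-symm (a-sees-outside bOp))))

    impossible : ∀ {b} → Outside G p b → ⊥
    impossible {b} bOp =
      let (a , pa , a≢q) = p-has-other-neighbour bOp
          ab = a-sees-outside pa a≢q bOp
      in notP₄ (path₄ (adj-symm pq) pa ab
           (λ qa → adj⇒≢ pa (sym (only-p qa))) (bOp ∘ inj₂) (λ qb → bOp (inj₁ (only-p qb)))
           (spanned pa a≢q))
      where
      spanned : ∀ {a} → Adjacent G p a → a ≢ q → ∀ z → z ∈ q ∷ p ∷ a ∷ b ∷ []
      spanned pa a≢q z with z ≟ q | z ≟ p | adj? p z
      ... | yes z≡q | _ | _ = here z≡q
      ... | no _ | yes z≡p | _ = there (here z≡p)
      ... | no z≢q | no _ | yes pz = there (there (here (only-a pa a≢q pz z≢q)))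
      ... | no _ | no z≢p | no ¬pz = there (there (there (here (only-b pa a≢q bOp (outside z≢p ¬pz)))))

  other-neighbour : ∀ {p q b} → Adjacent G p q → Outside G p b → ∃ λ c → Adjacent G q c × c ≢ p
  other-neighbour {p} {q} pq bOp with any? (λ c → adj? q c ×-dec ¬? (c ≟ p))
  ... | yes found = found
  ... | no none = ⊥-elim (Pendant.impossible pq only-p bOp)
    where
    only-p : ∀ {z} → Adjacent G q z → z ≡ p
    only-p {z} qz = decidable-stable (z ≟ p) (λ z≢p → none (z , qz , z≢p))

⌊⌋-true : ∀ {A : Set} (a? : Dec A) → A → ⌊ a? ⌋ ≡ true
⌊⌋-true a? a = trans (isYes≗does a?) (dec-true a? a)

⌊⌋-false : ∀ {A : Set} (a? : Dec A) → ¬ A → ⌊ a? ⌋ ≡ false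
⌊⌋-false a? ¬a = trans (isYes≗does a?) (dec-false a? ¬a)

-- Subdividing the edge uv of H: the new vertex is zero, and suc i is the
-- copy of the old vertex i.
module Subdivided (H : Graph) {u v : V H} (uv : Adjacent H u v) where
  open GraphFacts H

  H′ : Graph
  H′ = subdivideEdge H u v

  module F′ = GraphFacts H′

  IsEnd : V H → Set
  IsEnd = OneOf u v

  isEnd? : ∀ i → Dec (IsEnd i)
  isEnd? i = (i ≟ u) ⊎-dec (i ≟ v)

  end : V H → Bool
  end i = ⌊ i ≟ u ⌋ ∨ ⌊ i ≟ v ⌋

  end-true : ∀ {i} → end i ≡ true → IsEnd i
  end-true {i} e with i ≟ u | i ≟ v
  ... | yes i≡u | _ = inj₁ i≡u
  ... | no _ | yes i≡v = inj₂ i≡v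
  end-true {i} () | no _ | no _

  isEnd⇒true : ∀ {i} → IsEnd i → end i ≡ true
  isEnd⇒true {i} (inj₁ i≡u) = cong (_∨ ⌊ i ≟ v ⌋) (⌊⌋-true (i ≟ u) i≡u)
  isEnd⇒true {i} (inj₂ i≡v) =
    trans (cong (⌊ i ≟ u ⌋ ∨_) (⌊⌋-true (i ≟ v) i≡v)) (Bool.∨-zeroʳ _)

  ¬isEnd⇒false : ∀ {i} → ¬ IsEnd i → end i ≡ false
  ¬isEnd⇒false {i} ¬e =
    cong₂ _∨_ (⌊⌋-false (i ≟ u) (¬e ∘ inj₁)) (⌊⌋-false (i ≟ v) (¬e ∘ inj₂))

  old-adjacent : ∀ {i j} → Adjacent H′ (suc i) (suc j) → Adjacent H i j
  old-adjacent = Bool.∧-conicalˡ _ _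

  kept-edge : ∀ {i j} → Adjacent H i j → ¬ IsEnd i ⊎ ¬ IsEnd j → Adjacent H′ (suc i) (suc j)
  kept-edge {i} {j} ij (inj₁ ¬ei) rewrite ij | ¬isEnd⇒false ¬ei = refl
  kept-edge {i} {j} ij (inj₂ ¬ej) rewrite ij | ¬isEnd⇒false ¬ej | Bool.∧-zeroʳ (end i) = refl

  cut-edge : ∀ {i j} → IsEnd i → IsEnd j → ¬ Adjacent H′ (suc i) (suc j)
  cut-edge {i} {j} ei ej rewrite isEnd⇒true ei | isEnd⇒true ej | Bool.∧-zeroʳ (adj H i j) = λ ()

  edge-split : ∀ {i j} → Adjacent H i j → Adjacent H′ (suc i) (suc j) ⊎ (IsEnd i × IsEnd j)
  edge-split {i} {j} ij with isEnd? i | isEnd? j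
  ... | yes ei | yes ej = inj₂ (ei , ej)
  ... | no ¬ei | _ = inj₁ (kept-edge ij (inj₁ ¬ei))
  ... | yes _ | no ¬ej = inj₁ (kept-edge ij (inj₂ ¬ej))

  -- A walk in H becomes a walk in H′, passing through the new vertex
  -- whenever it uses the edge uv.
  lift : ∀ {P : V H → Set} {Q : V H′ → Set} →
    (∀ {a} → P a → Q (suc a)) → (P u → P v → Q zero) →
    ∀ {a b} → WalkIn H P a b → WalkIn H′ Q (suc a) (suc b)
  lift f mid (nil p) = nil (f p)
  lift {P} {Q} f mid (cons {a} {b} p ab w) with edge-split ab
  ... | inj₁ ab′ = cons (f p) ab′ (lift f mid w)
  ... | inj₂ (ea , eb) =
    cons (f p) (isEnd⇒true ea) (cons (via ea eb p (walk-first w)) (isEnd⇒true eb) (lift f mid w))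
    where
    via : IsEnd a → IsEnd b → P a → P b → Q zero
    via (inj₁ refl) (inj₂ refl) pa pb = mid pa pb
    via (inj₂ refl) (inj₁ refl) pa pb = mid pb pa
    via (inj₁ refl) (inj₁ refl) _ _ = ⊥-elim (adj⇒≢ ab refl)
    via (inj₂ refl) (inj₂ refl) _ _ = ⊥-elim (adj⇒≢ ab refl)

  connected′ : Connected H → Connected H′
  connected′ con zero zero = nil tt
  connected′ con zero (suc j) = cons tt (isEnd⇒true (inj₁ refl)) (lift _ _ (con u j))
  connected′ con (suc i) zero = F′.snocʷ (lift _ _ (con i u)) (isEnd⇒true (inj₁ refl)) tt
  connected′ con (suc i) (suc j) = lift _ _ (con i j)

  -- A triangle of H′ through the new vertex would contain the cut edge uv.
  triangleFree′ : TriangleFree H → TriangleFree H′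
  triangleFree′ tf (zero , zero , _ , () , _ , _)
  triangleFree′ tf (zero , suc y , zero , _ , _ , ())
  triangleFree′ tf (zero , suc y , suc z , my , yz , mz) = cut-edge (end-true my) (end-true mz) yz
  triangleFree′ tf (suc x , zero , zero , _ , () , _)
  triangleFree′ tf (suc x , zero , suc z , xm , mz , xz) = cut-edge (end-true xm) (end-true mz) xz
  triangleFree′ tf (suc x , suc y , zero , xy , ym , xm) = cut-edge (end-true xm) (end-true ym) xy
  triangleFree′ tf (suc x , suc y , suc z , xy , yz , xz) =
    tf (x , y , z , old-adjacent xy , old-adjacent yz , old-adjacent xz)

  module NoCutset (good : Good H) (notP₄ : ¬ H ≅ pathGraph 4) where
    open GoodNotP₄ H good notP₄

    outside-lift : ∀ {x z} → Outside H x z → Outside H′ (suc x) (suc z)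
    outside-lift o (inj₁ e) = o (inj₁ (suc-injective e))
    outside-lift o (inj₂ xz) = o (inj₂ (old-adjacent xz))

    mid-outside : ∀ {x} → ¬ IsEnd x → Outside H′ (suc x) zero
    mid-outside ¬ex (inj₁ ())
    mid-outside ¬ex (inj₂ xm) = ¬ex (end-true xm)

    lift-outside : ∀ {x a b} → WalkIn H (Outside H x) a b →
      WalkIn H′ (Outside H′ (suc x)) (suc a) (suc b)
    lift-outside = lift outside-lift (λ uO vO → mid-outside [ uO ∘ inj₁ ∘ sym , vO ∘ inj₁ ∘ sym ])

    -- N[zero] = {zero, u, v}, and H − {u, v} is connected.
    centre-mid : StarConnected H′ zero
    centre-mid {zero} mO _ = ⊥-elim (mO (inj₁ refl))
    centre-mid {suc _} {zero} _ mO = ⊥-elim (mO (inj₁ refl))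
    centre-mid {suc a} {suc b} aO bO =
      ¬¬-map (lift avoid⇒outside (λ ¬eu _ → ⊥-elim (¬eu (inj₁ refl))))
        (edge-deletion uv (aO ∘ inj₂ ∘ isEnd⇒true) (bO ∘ inj₂ ∘ isEnd⇒true))
      where
      avoid⇒outside : ∀ {z} → ¬ IsEnd z → Outside H′ zero (suc z)
      avoid⇒outside ¬e (inj₁ ())
      avoid⇒outside ¬e (inj₂ mz) = ¬e (end-true mz)

    -- For x off the edge, N[suc x] is the copy of N[x]; the new vertex is
    -- outside it and joined to an end of uv that is outside N[x] too.
    module _ {x} (¬ex : ¬ IsEnd x) where

      drop-outside : ∀ {z} → Outside H′ (suc x) (suc z) → Outside H x z
      drop-outside o (inj₁ e) = o (inj₁ (cong suc e))
      drop-outside o (inj₂ xz) = o (inj₂ (kept-edge xz (inj₁ ¬ex)))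

      end-outside : ∃ λ r → IsEnd r × Outside H x r
      end-outside with inClosedNbhd? x u | inClosedNbhd? x v
      ... | no uO | _ = u , inj₁ refl , uO
      ... | _ | no vO = v , inj₂ refl , vO
      ... | yes (inj₁ u≡x) | _ = ⊥-elim (¬ex (inj₁ (sym u≡x)))
      ... | _ | yes (inj₁ v≡x) = ⊥-elim (¬ex (inj₂ (sym v≡x)))
      ... | yes (inj₂ xu) | yes (inj₂ xv) = ⊥-elim (triangleFree (x , u , v , xu , uv , xv))

      to-old : ∀ {a} → Outside H′ (suc x) a →
        ∃ λ a₀ → Outside H x a₀ × WalkIn H′ (Outside H′ (suc x)) a (suc a₀)
      to-old {suc a₀} aO = a₀ , drop-outside aO , nil aO
      to-old {zero} mO =
        let (r , er , rO) = end-outside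
        in r , rO , cons mO (isEnd⇒true er) (nil (outside-lift rO))

      centre-away : StarConnected H′ (suc x)
      centre-away aO bO =
        let (a₀ , a₀O , wa) = to-old aO
            (b₀ , b₀O , wb) = to-old bO
        in ¬¬-map (λ w → wa F′.++ʷ (lift-outside w F′.++ʷ F′.reverseʷ wb))
                  (starConnected x a₀O b₀O)

    -- For an end x of the edge, with other end y, N[suc x] in H′ is the copy
    -- of N[x] with y replaced by the new vertex; y leaves through a further
    -- neighbour, which exists since N[x] is not everything.
    module _ {x y} (xy : Adjacent H x y) (ex : IsEnd x) (ey : IsEnd y)
             (ends : ∀ {z} → IsEnd z → OneOf x y z) where

      other-end-outside : Outside H′ (suc x) (suc y)
      other-end-outside (inj₁ e) = adj⇒≢ xy (sym (suc-injective e))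
      other-end-outside (inj₂ xy′) = cut-edge ex ey xy′

      classify : ∀ {a} → Outside H′ (suc x) a →
        a ≡ suc y ⊎ ∃ λ a₀ → a ≡ suc a₀ × Outside H x a₀
      classify {zero} mO = ⊥-elim (mO (inj₂ (isEnd⇒true ex)))
      classify {suc a₀} aO with inClosedNbhd? x a₀ | isEnd? a₀
      ... | no a₀O | _ = inj₂ (a₀ , refl , a₀O)
      ... | yes (inj₁ a₀≡x) | _ = ⊥-elim (aO (inj₁ (cong suc a₀≡x)))
      ... | yes (inj₂ xa₀) | no ¬e = ⊥-elim (aO (inj₂ (kept-edge xa₀ (inj₂ ¬e))))
      ... | yes (inj₂ xa₀) | yes e =
        [ (λ a₀≡x → ⊥-elim (adj⇒≢ xa₀ (sym a₀≡x))) , (λ a₀≡y → inj₁ (cong suc a₀≡y)) ]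
          (ends e)

      from-other-end : ∀ {b₀} → Outside H x b₀ →
        ¬ ¬ WalkIn H′ (Outside H′ (suc x)) (suc y) (suc b₀)
      from-other-end b₀O =
        let (c , yc , c≢x) = other-neighbour xy b₀O
            cO = neighbour-outside triangleFree (adj-symm xy) yc c≢x
            c-not-end = [ c≢x , adj⇒≢ yc ∘ sym ] ∘ ends
        in ¬¬-map (λ w → cons other-end-outside (kept-edge yc (inj₂ c-not-end)) (lift-outside w))
             (starConnected x cO b₀O)

      centre-end : StarConnected H′ (suc x)
      centre-end {a} {b} aO bO with classify aO | classify bO
      ... | inj₁ refl | inj₁ refl = pure (nil aO)
      ... | inj₁ refl | inj₂ (b₀ , refl , b₀O) = from-other-end b₀O
      ... | inj₂ (a₀ , refl , a₀O) | inj₁ refl = ¬¬-map F′.reverseʷ (from-other-end a₀O)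
      ... | inj₂ (a₀ , refl , a₀O) | inj₂ (b₀ , refl , b₀O) =
        ¬¬-map lift-outside (starConnected x a₀O b₀O)

    starConnected′ : ∀ c → StarConnected H′ c
    starConnected′ zero = centre-mid
    starConnected′ (suc x) with isEnd? x
    ... | no ¬ex = centre-away ¬ex
    ... | yes (inj₁ refl) = centre-end uv (inj₁ refl) (inj₂ refl) id
    ... | yes (inj₂ refl) = centre-end (adj-symm uv) (inj₂ refl) (inj₁ refl) swap

-- The invariant carried along a sequence of edge subdivisions.
Admissible : Graph → Set
Admissible G = Good G × ¬ IsSmallPath G

admissible-transport : ∀ {G H} → G ≅ H → Admissible G → Admissible H
admissible-transport φ (good , nsp) = good-transport φ good , nsp ∘ smallPath-transport φ

-- An admissible graph with an edge is not the path
-- on four vertices and has at least four vertices, so the subdivided graph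
-- is good and has at least five vertices, hence is not a short path.
subdivide-admissible : ∀ {H} → Admissible H → ∀ {u v} (uv : Adjacent H u v) →
  Admissible (subdivideEdge H u v)
subdivide-admissible {H} ((con , tf , nc) , nsp) uv =
  (connected′ con , triangleFree′ tf , starConnected⇒noCutset H′ (starConnected′ (con , tf , nc) notP₄)) ,
  not-short
  where
  open Subdivided H uv
  open NoCutset using (starConnected′)
  open GraphFacts using (starConnected⇒noCutset; four-vertices)

  notP₄ : ¬ H ≅ pathGraph 4
  notP₄ φ = nsp (4 , s≤s z≤n , ≤-refl , φ)

  not-short : ¬ IsSmallPath H′
  not-short sp = ≤⇒≯ (smallPath-size sp) (s≤s (four-vertices H con tf nsp uv))

admissible-subdivision : ∀ {G H} → Admissible G → Subdivision G H → Admissible H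
admissible-subdivision adm (base φ) = admissible-transport φ adm
admissible-subdivision adm (step s u v uv ψ) =
  admissible-transport (≅-sym ψ) (subdivide-admissible (admissible-subdivision adm s) uv)

mainTheorem20 : (G : Graph) → Connected G → TriangleFree G → ¬ HasFullStarCutset G →
    ¬ IsSmallPath G →
    (H : Graph) → Subdivision G H →
    Connected H × TriangleFree H × ¬ HasFullStarCutset H
mainTheorem20 G con tf nc nsp H s = proj₁ (admissible-subdivision ((con , tf , nc) , nsp) s)
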